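{- For every integer $n\geq 3$, let $F_{2,n}$ be the graph obtained from the $4$-cycle $C_4$ by adding $n-2$ pendant edges at a single vertex of $C_4$ (so $F_{2,n}$ has $n+2$ vertices and $n+2$ edges). Then $$r_2(F_{2,n})=\begin{cases} 2n-1, & \text{if } n \text{ is even},\\ 2n, & \text{if } n \text{ is odd}.\end{cases}$$
   Context: For a graph $H$, the Ramsey number $r_2(H)$ is the minimum integer $N$ such that every coloring of the edges of the complete graph $K_N$ with $2$ colors contains a monochromatic copy of $H$ (a subgraph isomorphic to $H$ all of whose edges have the same color). -}

module Defs where

open import Data.Nat using (ℕ; zero; suc; _+_; _<_; _≤_)
open import Data.Fin using (Fin; toℕ)
open import Data.Bool using (Bool; true; false; _∨_; _∧_)
open import Data.Product using (Σ; ∃; _×_; _,_)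
open import Relation.Binary.PropositionalEquality using (_≡_)
open import Relation.Nullary using (¬_)
open import Function.Definitions using (Injective)

record Graph : Set where
  field
    v     : ℕ
    adj   : Fin v → Fin v → Bool
    sym   : ∀ x y → adj x y ≡ adj y x
    irrefl : ∀ x → adj x x ≡ false

-- A 2-colouring of the edges of K_N: a colour for every unordered pair
-- {x,y} with x ≠ y, encoded as a symmetric function (diagonal values irrelevant).
record Colouring (N : ℕ) : Set where
  field
    col : Fin N → Fin N → Fin 2
    sym : ∀ x y → col x y ≡ col y x

MonoCopy : (H : Graph) {N : ℕ} → Colouring N → Set
MonoCopy H {N} c =
  Σ (Fin (Graph.v H) → Fin N) λ φ →
    Injective _≡_ _≡_ φ ×
    Σ (Fin 2) λ i →
      ∀ x y → Graph.adj H x y ≡ true → Colouring.col c (φ x) (φ y) ≡ i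

Arrows : ℕ → Graph → Set
Arrows N H = (c : Colouring N) → MonoCopy H c

IsRamsey2 : Graph → ℕ → Set
IsRamsey2 H R = Arrows R H × (∀ N → N < R → ¬ Arrows N H)

eqℕ : ℕ → ℕ → Bool
eqℕ zero zero = true
eqℕ zero (suc _) = false
eqℕ (suc _) zero = false
eqℕ (suc m) (suc n) = eqℕ m n

-- vertices 0,1,2,3 form the 4-cycle 0-1-2-3-0; vertices ≥ 4 are pendant at 0
isPend : ℕ → Bool
isPend 0 = false
isPend 1 = false
isPend 2 = false
isPend 3 = false
isPend (suc (suc (suc (suc _)))) = true

F-adjℕ : ℕ → ℕ → Bool
F-adjℕ a b =
  (eqℕ a 0 ∧ eqℕ b 1) ∨ (eqℕ a 1 ∧ eqℕ b 0) ∨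
  (eqℕ a 1 ∧ eqℕ b 2) ∨ (eqℕ a 2 ∧ eqℕ b 1) ∨
  (eqℕ a 2 ∧ eqℕ b 3) ∨ (eqℕ a 3 ∧ eqℕ b 2) ∨
  (eqℕ a 3 ∧ eqℕ b 0) ∨ (eqℕ a 0 ∧ eqℕ b 3) ∨
  (eqℕ a 0 ∧ isPend b) ∨ (isPend a ∧ eqℕ b 0)

private
  ∨-comm : ∀ a b → (a ∨ b) ≡ (b ∨ a)
  ∨-comm false false = _≡_.refl
  ∨-comm false true = _≡_.refl
  ∨-comm true false = _≡_.refl
  ∨-comm true true = _≡_.refl

F-symℕ : ∀ a b → F-adjℕ a b ≡ F-adjℕ b a
F-symℕ 0 0 = _≡_.refl
F-symℕ 0 1 = _≡_.refl
F-symℕ 0 2 = _≡_.refl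
F-symℕ 0 3 = _≡_.refl
F-symℕ 0 (suc (suc (suc (suc _)))) = _≡_.refl
F-symℕ 1 0 = _≡_.refl
F-symℕ 1 1 = _≡_.refl
F-symℕ 1 2 = _≡_.refl
F-symℕ 1 3 = _≡_.refl
F-symℕ 1 (suc (suc (suc (suc _)))) = _≡_.refl
F-symℕ 2 0 = _≡_.refl
F-symℕ 2 1 = _≡_.refl
F-symℕ 2 2 = _≡_.refl
F-symℕ 2 3 = _≡_.refl
F-symℕ 2 (suc (suc (suc (suc _)))) = _≡_.refl
F-symℕ 3 0 = _≡_.refl
F-symℕ 3 1 = _≡_.refl
F-symℕ 3 2 = _≡_.refl
F-symℕ 3 3 = _≡_.refl
F-symℕ 3 (suc (suc (suc (suc _)))) = _≡_.refl
F-symℕ (suc (suc (suc (suc _)))) 0 = _≡_.refl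
F-symℕ (suc (suc (suc (suc _)))) 1 = _≡_.refl
F-symℕ (suc (suc (suc (suc _)))) 2 = _≡_.refl
F-symℕ (suc (suc (suc (suc _)))) 3 = _≡_.refl
F-symℕ (suc (suc (suc (suc _)))) (suc (suc (suc (suc _)))) = _≡_.refl

F-irreflℕ : ∀ a → F-adjℕ a a ≡ false
F-irreflℕ 0 = _≡_.refl
F-irreflℕ 1 = _≡_.refl
F-irreflℕ 2 = _≡_.refl
F-irreflℕ 3 = _≡_.refl
F-irreflℕ (suc (suc (suc (suc _)))) = _≡_.refl

F2 : ℕ → Graph
F2 n = record
  { v = n + 2
  ; adj = λ x y → F-adjℕ (toℕ x) (toℕ y)
  ; sym = λ x y → F-symℕ (toℕ x) (toℕ y)
  ; irrefl = λ x → F-irreflℕ (toℕ x)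
  }

module Submission where

-- Write n = m + 2.  The centre of F_{2,n} has degree n, which drives both bounds.
-- Lower bound (no-copy-if-low-degree): if every vertex has at most n − 1
-- neighbours of each colour there is no monochromatic F_{2,n}; such colourings
-- are two red cliques of size n − 1 joined in blue (even n, 2n − 2 vertices) and
-- the circulant colouring by cyclic distance on 2n − 1 vertices (odd n).
-- Upper bound (HighDegree.high-degree): on at least n + 3 vertices, a vertex x
-- with n neighbours R of one colour yields a monochromatic 4-cycle plus n − 2
-- pendants (copy-from-cycle), by a case analysis on how the vertices see R.
-- On 2n vertices some vertex has such a colour class; on 2n − 1 vertices with n
-- even, otherwise all colour-0 degrees equal n − 1, contradicting the handshake
-- lemma as (2n − 1)(n − 1) is odd.

open import Defs
open import Data.Nat using (ℕ; zero; suc; _+_; _*_; _∸_; _≤_; _<_; z≤n; s≤s; _≤?_; _<?_; _<ᵇ_; _≟_)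
open import Data.Nat.Properties
open import Data.Nat.DivMod using (_mod_; m<n⇒m%n≡m)
open import Data.Nat.Divisibility using (_∣_; divides; _∣0; ∣m∣n⇒∣m+n; ∣m+n∣m⇒∣n; ∣1⇒≡1)
open import Data.Nat.Primality using (prime[2]; euclidsLemma)
open import Data.Nat.Tactic.RingSolver using (solve-∀)
open import Algebra.Properties.CommutativeSemigroup +-commutativeSemigroup using (interchange)
open import Algebra.Properties.CommutativeMonoid.Sum +-0-commutativeMonoid using (sum; ∑-distrib-+; sum-cong-≗)
open import Data.Fin using (Fin; zero; suc; toℕ; inject≤)
open import Data.Fin.Properties using (toℕ-injective; toℕ<n; toℕ-fromℕ<; inject≤-injective; any?) renaming (_≟_ to _≟ᶠ_)
open import Data.Bool using (Bool; true; false; _∧_; _∨_; not; _xor_; if_then_else_)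
open import Data.Bool.Properties using (∧-comm; ∧-conicalˡ; ∧-conicalʳ; ∧-identityʳ; ∧-zeroʳ; ∨-comm; ∨-conicalˡ; ∨-conicalʳ; not-involutive) renaming (_≟_ to _≟ᵇ_)
open import Data.Product using (Σ; _×_; _,_)
open import Data.Sum using (_⊎_; inj₁; inj₂)
open import Data.Empty using (⊥; ⊥-elim)
open import Relation.Nullary using (¬_; Dec; yes; no; does)
open import Relation.Nullary.Decidable using (dec-true; dec-false; _×-dec_; _⊎-dec_)
open import Relation.Binary.PropositionalEquality

holds : ∀ {A : Set} (d : Dec A) → does d ≡ true → A
holds (yes a) _ = a

_==_ : ∀ {N} → Fin N → Fin N → Bool
a == b = does (a ≟ᶠ b)

==-sound : ∀ {N} {a b : Fin N} → (a == b) ≡ true → a ≡ b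
==-sound {a = a} {b} = holds (a ≟ᶠ b)

==-refl : ∀ {N} (a : Fin N) → (a == a) ≡ true
==-refl a = dec-true (a ≟ᶠ a) refl

==-false : ∀ {N} {a b : Fin N} → a ≢ b → (a == b) ≡ false
==-false {a = a} {b} = dec-false (a ≟ᶠ b)

==-sym : ∀ {N} (a b : Fin N) → (a == b) ≡ (b == a)
==-sym a b with a ≟ᶠ b
... | yes refl = sym (==-refl a)
... | no a≢b = sym (==-false (λ e → a≢b (sym e)))

∧-intro : ∀ {a b} → a ≡ true → b ≡ true → (a ∧ b) ≡ true
∧-intro refl refl = refl

∨-introˡ : ∀ {a} b → a ≡ true → (a ∨ b) ≡ true
∨-introˡ b refl = refl

∨-introʳ : ∀ a {b} → b ≡ true → (a ∨ b) ≡ true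
∨-introʳ true _ = refl
∨-introʳ false h = h

xor-comm : ∀ a b → (a xor b) ≡ (b xor a)
xor-comm true true = refl
xor-comm true false = refl
xor-comm false true = refl
xor-comm false false = refl

bit : Bool → ℕ
bit b = if b then 1 else 0

count : ∀ {N} → (Fin N → Bool) → ℕ
count {zero} f = 0
count {suc N} f = bit (f zero) + count (λ u → f (suc u))

_∩_ _∖_ _∪_ : ∀ {N} → (Fin N → Bool) → (Fin N → Bool) → Fin N → Bool
(f ∩ g) u = f u ∧ g u
(f ∖ g) u = f u ∧ not (g u)
(f ∪ g) u = f u ∨ g u

without : ∀ {N} → (Fin N → Bool) → Fin N → Fin N → Bool
without f a u = f u ∧ not (u == a)

without-⊆ : ∀ {N} (f : Fin N → Bool) {a u} → without f a u ≡ true → f u ≡ true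
without-⊆ f {a} {u} = ∧-conicalˡ (f u) (not (u == a))

without-≢ : ∀ {N} (f : Fin N → Bool) {a u} → without f a u ≡ true → u ≢ a
without-≢ f {u = u} h refl = not-both (u == u) (==-refl u) (∧-conicalʳ (f u) (not (u == u)) h)
  where
  not-both : ∀ b → b ≡ true → not b ≡ true → ⊥
  not-both true _ ()

without-intro : ∀ {N} (f : Fin N → Bool) {a u} → f u ≡ true → u ≢ a → without f a u ≡ true
without-intro f {a} {u} fu u≢a rewrite fu | ==-false u≢a = refl

count-ext : ∀ {N} {f g : Fin N → Bool} → (∀ u → f u ≡ g u) → count f ≡ count g
count-ext {zero} _ = refl
count-ext {suc N} f≗g = cong₂ _+_ (cong bit (f≗g zero)) (count-ext (λ u → f≗g (suc u)))

count-mono : ∀ {N} {f g : Fin N → Bool} → (∀ u → f u ≡ true → g u ≡ true) → count f ≤ count g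
count-mono {zero} _ = z≤n
count-mono {suc N} {f} {g} f⊆g =
  +-mono-≤ (bit-mono (f zero) (g zero) (f⊆g zero)) (count-mono (λ u → f⊆g (suc u)))
  where
  bit-mono : ∀ a b → (a ≡ true → b ≡ true) → bit a ≤ bit b
  bit-mono false b _ = z≤n
  bit-mono true b a⇒b rewrite a⇒b refl = ≤-refl

count-all : ∀ {N} → count {N} (λ _ → true) ≡ N
count-all {zero} = refl
count-all {suc N} = cong suc (count-all {N})

count-split : ∀ {N} (f g : Fin N → Bool) → count f ≡ count (f ∩ g) + count (f ∖ g)
count-split {zero} f g = refl
count-split {suc N} f g =
  trans (cong₂ _+_ (bit-split (f zero) (g zero)) (count-split (λ u → f (suc u)) (λ u → g (suc u))))
        (interchange (bit (f zero ∧ g zero)) _ _ _)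
  where
  bit-split : ∀ a b → bit a ≡ bit (a ∧ b) + bit (a ∧ not b)
  bit-split false b = refl
  bit-split true false = refl
  bit-split true true = refl

count-∪ : ∀ {N} (f g : Fin N → Bool) → count (f ∪ g) ≤ count f + count g
count-∪ {zero} f g = z≤n
count-∪ {suc N} f g =
  ≤-trans (+-mono-≤ (bit-∨ (f zero) (g zero)) (count-∪ (λ u → f (suc u)) (λ u → g (suc u))))
          (≤-reflexive (interchange (bit (f zero)) (bit (g zero)) _ _))
  where
  bit-∨ : ∀ a b → bit (a ∨ b) ≤ bit a + bit b
  bit-∨ false b = ≤-refl
  bit-∨ true false = ≤-refl
  bit-∨ true true = s≤s z≤n

count-witness : ∀ {N} (f : Fin N → Bool) → 0 < count f → Σ (Fin N) λ u → f u ≡ true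
count-witness {suc N} f pos with f zero in fz
... | true = zero , fz
... | false = let (u , fu) = count-witness (λ u → f (suc u)) pos in suc u , fu

count-without-member : ∀ {N} (f : Fin N → Bool) {a} → f a ≡ true → count f ≡ suc (count (without f a))
count-without-member {suc N} f {zero} fa rewrite fa =
  cong suc (count-ext (λ u → sym (∧-identityʳ (f (suc u)))))
count-without-member {suc N} f {suc a} fa = begin
  bit (f zero) + count f′
    ≡⟨ cong (bit (f zero) +_) (count-without-member f′ fa) ⟩
  bit (f zero) + suc (count (without f′ a))
    ≡⟨ +-suc (bit (f zero)) (count (without f′ a)) ⟩
  suc (bit (f zero) + count (without f′ a))
    ≡⟨ cong (λ b → suc (bit b + count (without f′ a))) (sym (∧-identityʳ (f zero))) ⟩
  suc (count (without f (suc a))) ∎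
  where
  open ≡-Reasoning
  f′ : Fin N → Bool
  f′ u = f (suc u)

count-without-nonmember : ∀ {N} (f : Fin N → Bool) {a} → f a ≡ false → count (without f a) ≡ count f
count-without-nonmember f {a} fa = count-ext removed
  where
  removed : ∀ u → without f a u ≡ f u
  removed u with u ≟ᶠ a
  ... | yes refl = trans (∧-zeroʳ (f u)) (sym fa)
  ... | no _ = ∧-identityʳ (f u)

count-without : ∀ {N} (f : Fin N → Bool) (a : Fin N) → count f ≤ suc (count (without f a))
count-without f a with f a in fa
... | true = ≤-reflexive (count-without-member f fa)
... | false = ≤-trans (≤-reflexive (sym (count-without-nonmember f fa))) (n≤1+n _)

count-without-≤ : ∀ {N} (f : Fin N → Bool) (a : Fin N) → count (without f a) ≤ count f
count-without-≤ f a = count-mono {f = without f a} (λ u → without-⊆ f)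

count-member : ∀ {N} (f : Fin N → Bool) {a} → f a ≡ true → 0 < count f
count-member f fa = subst (0 <_) (sym (count-without-member f fa)) (s≤s z≤n)

count-two : ∀ {N} (f : Fin N → Bool) → 2 ≤ count f →
  Σ (Fin N) λ a → Σ (Fin N) λ b → f a ≡ true × f b ≡ true × a ≢ b
count-two f two with count-witness f (≤-trans (s≤s z≤n) two)
... | a , fa with count-witness (without f a) (≤-pred (subst (2 ≤_) (count-without-member f fa) two))
... | b , fb = a , b , fa , without-⊆ f fb , λ a≡b → without-≢ f fb (sym a≡b)

count-≤1 : ∀ {N} (f : Fin N → Bool) → count f ≤ 1 → ∀ {a b} → f a ≡ true → f b ≡ true → a ≡ b
count-≤1 f one {a} {b} fa fb with a ≟ᶠ b
... | yes a≡b = a≡b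
... | no a≢b = ⊥-elim (<-irrefl refl (≤-trans two one))
  where
  two : 2 ≤ count f
  two = subst (2 ≤_) (sym (count-without-member f fa))
          (s≤s (count-member (without f a) (without-intro f fb (λ b≡a → a≢b (sym b≡a)))))

count-unique : ∀ {N} (f : Fin N → Bool) →
  (∀ {a b} → f a ≡ true → f b ≡ true → a ≡ b) → count f ≤ 1
count-unique f unique = ≮⇒≥ two-impossible
  where
  two-impossible : ¬ (2 ≤ count f)
  two-impossible two with count-two f two
  ... | a , b , fa , fb , a≢b = a≢b (unique fa fb)

count-all-but-one : ∀ {N} (f g : Fin N → Bool) → count (f ∖ g) ≤ 1 → count f ≤ suc (count (f ∩ g))
count-all-but-one f g one = begin
  count f                         ≡⟨ count-split f g ⟩
  count (f ∩ g) + count (f ∖ g)   ≤⟨ +-monoʳ-≤ (count (f ∩ g)) one ⟩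
  count (f ∩ g) + 1               ≡⟨ +-comm (count (f ∩ g)) 1 ⟩
  suc (count (f ∩ g))             ∎
  where open ≤-Reasoning

-- k distinct members give count at least k.  Families of vertices are
-- indexed by ℕ; only the indices below k matter.
count-injection : ∀ {N} (k : ℕ) (f : Fin N → Bool) (g : ℕ → Fin N) →
  (∀ s → s < k → f (g s) ≡ true) →
  (∀ s t → s < k → t < k → g s ≡ g t → s ≡ t) → k ≤ count f
count-injection zero f g _ _ = z≤n
count-injection (suc k) f g members distinct =
  subst (suc k ≤_) (sym (count-without-member f (members k ≤-refl)))
    (s≤s (count-injection k (without f (g k)) g members′
           (λ s t s<k t<k → distinct s t (m≤n⇒m≤1+n s<k) (m≤n⇒m≤1+n t<k))))
  where
  members′ : ∀ s → s < k → without f (g k) (g s) ≡ true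
  members′ s s<k = without-intro f (members s (m≤n⇒m≤1+n s<k))
    (λ e → <-irrefl (distinct s k (m≤n⇒m≤1+n s<k) ≤-refl e) s<k)

-- Conversely, a set of size at least k can be listed as k distinct members
-- (the default vertex d fills the indices beyond k).
enumerate : ∀ {N} (d : Fin N) (k : ℕ) (f : Fin N → Bool) → k ≤ count f →
  Σ (ℕ → Fin N) λ g → (∀ s → s < k → f (g s) ≡ true) ×
                      (∀ s t → s < k → t < k → g s ≡ g t → s ≡ t)
enumerate d zero f _ = (λ _ → d) , (λ _ ()) , (λ _ _ ())
enumerate {N} d (suc k) f k<f with count-witness f (≤-trans (s≤s z≤n) k<f)
... | a , fa with enumerate d k (without f a) (≤-pred (subst (suc k ≤_) (count-without-member f fa) k<f))
... | g , members , distinct = next , members′ , distinct′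
  where
  next : ℕ → Fin N
  next zero = a
  next (suc s) = g s
  members′ : ∀ s → s < suc k → f (next s) ≡ true
  members′ zero _ = fa
  members′ (suc s) (s≤s s<k) = without-⊆ f (members s s<k)
  distinct′ : ∀ s t → s < suc k → t < suc k → next s ≡ next t → s ≡ t
  distinct′ zero zero _ _ _ = refl
  distinct′ zero (suc t) _ (s≤s t<k) e = ⊥-elim (without-≢ f (members t t<k) (sym e))
  distinct′ (suc s) zero (s≤s s<k) _ e = ⊥-elim (without-≢ f (members s s<k) e)
  distinct′ (suc s) (suc t) (s≤s s<k) (s≤s t<k) e = cong suc (distinct s t s<k t<k e)

count-below : ∀ {N} a → a ≤ N → count {N} (λ u → toℕ u <ᵇ a) ≡ a
count-below {zero} zero _ = refl
count-below {suc N} zero _ = count-below {N} zero z≤n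
count-below {suc N} (suc a) (s≤s a≤N) = cong suc (count-below {N} a a≤N)

in-interval : ℕ → ℕ → ℕ → Bool
in-interval a L p = does (a <? p) ∧ does (p ≤? a + L)

in-interval-intro : ∀ {a L p} → a < p → p ≤ a + L → in-interval a L p ≡ true
in-interval-intro {a} {L} {p} lo hi = ∧-intro (dec-true (a <? p) lo) (dec-true (p ≤? a + L) hi)

in-interval-lower : ∀ {a L p} → in-interval a L p ≡ true → a < p
in-interval-lower {a} {L} {p} h = holds (a <? p) (∧-conicalˡ _ _ h)

in-interval-upper : ∀ {a L p} → in-interval a L p ≡ true → p ≤ a + L
in-interval-upper {a} {L} {p} h = holds (p ≤? a + L) (∧-conicalʳ (does (a <? p)) _ h)

count-interval : ∀ {N} (h : Fin N → ℕ) → (∀ {u v} → h u ≡ h v → u ≡ v) → ∀ a L →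
  count (λ u → in-interval a L (h u)) ≤ L
count-interval h h-inj a zero = ≮⇒≥ empty
  where
  empty : ¬ (0 < count (λ u → in-interval a 0 (h u)))
  empty nonempty with count-witness _ nonempty
  ... | u , hu = <⇒≱ (in-interval-lower hu) (subst (h u ≤_) (+-identityʳ a) (in-interval-upper hu))
count-interval {N} h h-inj a (suc L) = begin
  count (λ u → in-interval a (suc L) (h u))       ≤⟨ count-mono shorter-or-last ⟩
  count (shorter ∪ last)                          ≤⟨ count-∪ shorter last ⟩
  count shorter + count last                      ≤⟨ +-mono-≤ (count-interval h h-inj a L)
                                                                (count-unique last last-unique) ⟩
  L + 1                                           ≡⟨ +-comm L 1 ⟩
  suc L ∎
  where
  open ≤-Reasoning
  shorter last : Fin N → Bool
  shorter u = in-interval a L (h u)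
  last u = does (h u ≟ a + suc L)
  last-unique : ∀ {u v} → last u ≡ true → last v ≡ true → u ≡ v
  last-unique {u} {v} hu hv = h-inj (trans (holds (h u ≟ a + suc L) hu) (sym (holds (h v ≟ a + suc L) hv)))
  shorter-or-last : ∀ u → in-interval a (suc L) (h u) ≡ true → (shorter ∪ last) u ≡ true
  shorter-or-last u hu with m≤n⇒m<n∨m≡n (in-interval-upper hu)
  ... | inj₁ below = ∨-introˡ (last u)
        (in-interval-intro (in-interval-lower hu) (≤-pred (subst (suc (h u) ≤_) (+-suc a L) below)))
  ... | inj₂ at-end = ∨-introʳ (shorter u) (dec-true (h u ≟ a + suc L) at-end)

leaves : ∀ {k m d p} → k + m ≤ d → d ≤ k + p → m ≤ p
leaves {k} k+m≤d d≤k+p = +-cancelˡ-≤ k _ _ (≤-trans k+m≤d d≤k+p)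

sum-split-lower : ∀ {q p K L} → q + p ≡ K + L → p ≤ L → K ≤ q
sum-split-lower {q} {p} {K} {L} e p≤L =
  +-cancelʳ-≤ p K q (≤-trans (+-monoʳ-≤ K p≤L) (≤-reflexive (sym e)))

sum-split-upper : ∀ {q p K L} → q + p ≡ K + L → L ≤ p → q ≤ K
sum-split-upper {q} {p} {K} {L} e L≤p =
  +-cancelʳ-≤ L q K (≤-trans (+-monoʳ-≤ q L≤p) (≤-reflexive e))

sum-bits : ∀ {N} (f : Fin N → Bool) → sum (λ u → bit (f u)) ≡ count f
sum-bits {zero} f = refl
sum-bits {suc N} f = cong (bit (f zero) +_) (sum-bits (λ u → f (suc u)))

sum-const : ∀ {N} c → sum {N} (λ _ → c) ≡ N * c
sum-const {zero} c = refl
sum-const {suc N} c = cong (c +_) (sum-const {N} c)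

double≡*2 : ∀ t → t + t ≡ t * 2
double≡*2 = solve-∀

-- Split off vertex 0: its edges are counted once in its own
-- degree and once among the degrees of the other vertices.
handshake : ∀ {N} (E : Fin N → Fin N → Bool) → (∀ u v → E u v ≡ E v u) → (∀ u → E u u ≡ false) →
  2 ∣ sum (λ u → count (E u))
handshake {zero} E _ _ = 2 ∣0
handshake {suc N} E E-sym E-irrefl =
  subst (2 ∣_) (sym split) (∣m∣n⇒∣m+n (divides A (double≡*2 A)) rest-even)
  where
  open ≡-Reasoning
  A : ℕ
  A = count (λ v → E zero (suc v))
  rest : ℕ
  rest = sum (λ u → count (λ v → E (suc u) (suc v)))
  rest-even : 2 ∣ rest
  rest-even = handshake (λ u v → E (suc u) (suc v)) (λ u v → E-sym (suc u) (suc v)) (λ u → E-irrefl (suc u))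
  split : sum (λ u → count (E u)) ≡ (A + A) + rest
  split = begin
    count (E zero) + sum (λ u → bit (E (suc u) zero) + count (λ v → E (suc u) (suc v)))
      ≡⟨ cong₂ _+_ (cong (λ b → bit b + A) (E-irrefl zero))
                   (∑-distrib-+ (λ u → bit (E (suc u) zero)) (λ u → count (λ v → E (suc u) (suc v)))) ⟩
    A + (sum (λ u → bit (E (suc u) zero)) + rest)
      ≡⟨ cong (λ s → A + (s + rest))
              (trans (sum-bits (λ u → E (suc u) zero)) (count-ext (λ u → E-sym (suc u) zero))) ⟩
    A + (A + rest)
      ≡⟨ sym (+-assoc A A rest) ⟩
    (A + A) + rest ∎

consecutive : ∀ {n} → 2 ∣ n → ¬ 2 ∣ suc n
consecutive {n} 2∣n 2∣1+n with ∣1⇒≡1 (∣m+n∣m⇒∣n (subst (2 ∣_) (+-comm 1 n) 2∣1+n) 2∣n)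
... | ()

halve : ∀ n → (Σ ℕ λ t → n ≡ t + t) ⊎ (Σ ℕ λ t → n ≡ suc (t + t))
halve zero = inj₁ (0 , refl)
halve (suc n) with halve n
... | inj₁ (t , e) = inj₂ (t , cong suc e)
... | inj₂ (t , e) = inj₁ (suc t , cong suc (trans e (sym (+-suc t t))))

odd-half : ∀ n → ¬ 2 ∣ n → Σ ℕ λ t → n ≡ suc (t + t)
odd-half n odd with halve n
... | inj₁ (t , e) = ⊥-elim (odd (divides t (trans e (double≡*2 t))))
... | inj₂ half = half

col-flip : ∀ {N} (C : Colouring N) {u v k} → Colouring.col C u v ≡ k → Colouring.col C v u ≡ k
col-flip C {u} {v} h = trans (Colouring.sym C v u) h

other : Fin 2 → Fin 2
other zero = suc zero
other (suc zero) = zero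

==-other : ∀ (c i : Fin 2) → (c == other i) ≡ not (c == i)
==-other zero zero = refl
==-other zero (suc zero) = refl
==-other (suc zero) zero = refl
==-other (suc zero) (suc zero) = refl

other-≢ : ∀ (i : Fin 2) → i ≢ other i
other-≢ zero ()
other-≢ (suc zero) ()

Nbhd : ∀ {N} → Colouring N → Fin 2 → Fin N → Fin N → Bool
Nbhd C i x = without (λ u → Colouring.col C x u == i) x

deg : ∀ {N} → Colouring N → Fin 2 → Fin N → ℕ
deg C i x = count (Nbhd C i x)

Nbhd-col : ∀ {N} (C : Colouring N) {i x u} → Nbhd C i x u ≡ true → Colouring.col C x u ≡ i
Nbhd-col C {i} {x} h = ==-sound (without-⊆ (λ u → Colouring.col C x u == i) h)

degree-sum : ∀ {N} (C : Colouring N) (i : Fin 2) (x : Fin N) → suc (deg C i x + deg C (other i) x) ≡ N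
degree-sum {N} C i x = begin
  suc (deg C i x + deg C (other i) x)
    ≡⟨ cong suc (cong₂ _+_ (count-ext in-colour) (count-ext in-other)) ⟩
  suc (count (others ∩ E) + count (others ∖ E))  ≡⟨ cong suc (sym (count-split others E)) ⟩
  suc (count others)                              ≡⟨ sym (count-without-member {N} (λ _ → true) {x} refl) ⟩
  count {N} (λ _ → true)                          ≡⟨ count-all ⟩
  N                                               ∎
  where
  open ≡-Reasoning
  E others : Fin N → Bool
  E u = Colouring.col C x u == i
  others = without (λ _ → true) x
  in-colour : ∀ u → Nbhd C i x u ≡ (others ∩ E) u
  in-colour u = ∧-comm (E u) (not (u == x))
  in-other : ∀ u → Nbhd C (other i) x u ≡ (others ∖ E) u
  in-other u = trans (cong (_∧ not (u == x)) (==-other (Colouring.col C x u) i))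
                     (∧-comm (not (E u)) (not (u == x)))

other-colour-large : ∀ {N} (C : Colouring N) (i : Fin 2) (x : Fin N) (K L : ℕ) →
  N ≡ suc (K + L) → deg C i x ≤ L → K ≤ deg C (other i) x
other-colour-large C i x K L N≡ few =
  sum-split-lower (trans (+-comm (deg C (other i) x) (deg C i x)) (suc-injective (trans (degree-sum C i x) N≡))) few

-- A 4-cycle z–a–b–w–z of colour k in the colouring C; z is the vertex that
-- will carry the pendant edges.
record Cycle4 {N : ℕ} (C : Colouring N) (k : Fin 2) : Set where
  field
    z a b w : Fin N
    z≢a : z ≢ a
    z≢b : z ≢ b
    z≢w : z ≢ w
    a≢b : a ≢ b
    a≢w : a ≢ w
    b≢w : b ≢ w
    za : Colouring.col C z a ≡ k
    ab : Colouring.col C a b ≡ k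
    bw : Colouring.col C b w ≡ k
    wz : Colouring.col C w z ≡ k

record Pendant {N : ℕ} {C : Colouring N} {k : Fin 2} (Q : Cycle4 C k) (u : Fin N) : Set where
  open Cycle4 Q
  field
    joined : Colouring.col C z u ≡ k
    u≢z : u ≢ z
    u≢a : u ≢ a
    u≢b : u ≢ b
    u≢w : u ≢ w

copy-from-cycle : ∀ {N} {C : Colouring N} {k : Fin 2} (Q : Cycle4 C k) (m : ℕ) (P : Fin N → Bool) →
  m ≤ count P → (∀ u → P u ≡ true → Pendant Q u) → MonoCopy (F2 (suc (suc m))) C
copy-from-cycle {N} {C} {k} Q m P m≤P pendant with enumerate (Cycle4.z Q) m P m≤P
... | g , g-member , g-distinct =
  (λ x → ψ (toℕ x)) ,
  (λ {x} {y} e → toℕ-injective (ψ-injective (toℕ x) (toℕ y) (toℕ<n x) (toℕ<n y) e)) ,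
  k , (λ x y adj → ψ-edge (toℕ x) (toℕ y) adj (toℕ<n x) (toℕ<n y))
  where
  open Cycle4 Q

  col : Fin N → Fin N → Fin 2
  col = Colouring.col C

  L : ℕ
  L = suc (suc m) + 2

  pendant-index : ∀ s → 4 + s < L → s < m
  pendant-index s (s≤s (s≤s lt)) with subst (3 + s ≤_) (+-comm m 2) lt
  ... | s≤s (s≤s s<m) = s<m

  pendant-at : ∀ s → 4 + s < L → Pendant Q (g s)
  pendant-at s lt = pendant (g s) (g-member s (pendant-index s lt))

  ψ : ℕ → Fin N
  ψ 0 = z
  ψ 1 = a
  ψ 2 = b
  ψ 3 = w
  ψ (suc (suc (suc (suc s)))) = g s

  ψ-edge : ∀ p q → F-adjℕ p q ≡ true → p < L → q < L → col (ψ p) (ψ q) ≡ k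
  ψ-edge 0 1 _ _ _ = za
  ψ-edge 0 3 _ _ _ = col-flip C wz
  ψ-edge 0 (suc (suc (suc (suc t)))) _ _ lt = Pendant.joined (pendant-at t lt)
  ψ-edge 1 0 _ _ _ = col-flip C za
  ψ-edge 1 2 _ _ _ = ab
  ψ-edge 2 1 _ _ _ = col-flip C ab
  ψ-edge 2 3 _ _ _ = bw
  ψ-edge 3 0 _ _ _ = wz
  ψ-edge 3 2 _ _ _ = col-flip C bw
  ψ-edge (suc (suc (suc (suc s)))) 0 _ lt _ = col-flip C (Pendant.joined (pendant-at s lt))
  ψ-edge 0 0 () _ _
  ψ-edge 0 2 () _ _
  ψ-edge 1 1 () _ _
  ψ-edge 1 3 () _ _
  ψ-edge 1 (suc (suc (suc (suc t)))) () _ _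
  ψ-edge 2 0 () _ _
  ψ-edge 2 2 () _ _
  ψ-edge 2 (suc (suc (suc (suc t)))) () _ _
  ψ-edge 3 1 () _ _
  ψ-edge 3 3 () _ _
  ψ-edge 3 (suc (suc (suc (suc t)))) () _ _
  ψ-edge (suc (suc (suc (suc s)))) 1 () _ _
  ψ-edge (suc (suc (suc (suc s)))) 2 () _ _
  ψ-edge (suc (suc (suc (suc s)))) 3 () _ _
  ψ-edge (suc (suc (suc (suc s)))) (suc (suc (suc (suc t)))) () _ _

  ψ-injective : ∀ p q → p < L → q < L → ψ p ≡ ψ q → p ≡ q
  ψ-injective 0 0 _ _ _ = refl
  ψ-injective 1 1 _ _ _ = refl
  ψ-injective 2 2 _ _ _ = refl
  ψ-injective 3 3 _ _ _ = refl
  ψ-injective 0 1 _ _ e = ⊥-elim (z≢a e)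
  ψ-injective 0 2 _ _ e = ⊥-elim (z≢b e)
  ψ-injective 0 3 _ _ e = ⊥-elim (z≢w e)
  ψ-injective 1 2 _ _ e = ⊥-elim (a≢b e)
  ψ-injective 1 3 _ _ e = ⊥-elim (a≢w e)
  ψ-injective 2 3 _ _ e = ⊥-elim (b≢w e)
  ψ-injective 1 0 _ _ e = ⊥-elim (z≢a (sym e))
  ψ-injective 2 0 _ _ e = ⊥-elim (z≢b (sym e))
  ψ-injective 3 0 _ _ e = ⊥-elim (z≢w (sym e))
  ψ-injective 2 1 _ _ e = ⊥-elim (a≢b (sym e))
  ψ-injective 3 1 _ _ e = ⊥-elim (a≢w (sym e))
  ψ-injective 3 2 _ _ e = ⊥-elim (b≢w (sym e))
  ψ-injective (suc (suc (suc (suc s)))) 0 ls _ e = ⊥-elim (Pendant.u≢z (pendant-at s ls) e)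
  ψ-injective (suc (suc (suc (suc s)))) 1 ls _ e = ⊥-elim (Pendant.u≢a (pendant-at s ls) e)
  ψ-injective (suc (suc (suc (suc s)))) 2 ls _ e = ⊥-elim (Pendant.u≢b (pendant-at s ls) e)
  ψ-injective (suc (suc (suc (suc s)))) 3 ls _ e = ⊥-elim (Pendant.u≢w (pendant-at s ls) e)
  ψ-injective 0 (suc (suc (suc (suc t)))) _ lt e = ⊥-elim (Pendant.u≢z (pendant-at t lt) (sym e))
  ψ-injective 1 (suc (suc (suc (suc t)))) _ lt e = ⊥-elim (Pendant.u≢a (pendant-at t lt) (sym e))
  ψ-injective 2 (suc (suc (suc (suc t)))) _ lt e = ⊥-elim (Pendant.u≢b (pendant-at t lt) (sym e))
  ψ-injective 3 (suc (suc (suc (suc t)))) _ lt e = ⊥-elim (Pendant.u≢w (pendant-at t lt) (sym e))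
  ψ-injective (suc (suc (suc (suc s)))) (suc (suc (suc (suc t)))) ls lt e =
    cong (λ r → 4 + r) (g-distinct s t (pendant-index s ls) (pendant-index t lt) e)

centre-nbr : ℕ → ℕ
centre-nbr 0 = 1
centre-nbr 1 = 3
centre-nbr (suc (suc s)) = 4 + s

centre-nbr-adjacent : ∀ s → F-adjℕ 0 (centre-nbr s) ≡ true
centre-nbr-adjacent 0 = refl
centre-nbr-adjacent 1 = refl
centre-nbr-adjacent (suc (suc s)) = refl

centre-nbr-nonzero : ∀ s → centre-nbr s ≢ 0
centre-nbr-nonzero 0 ()
centre-nbr-nonzero 1 ()
centre-nbr-nonzero (suc (suc s)) ()

centre-nbr-injective : ∀ s t → centre-nbr s ≡ centre-nbr t → s ≡ t
centre-nbr-injective 0 0 _ = refl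
centre-nbr-injective 1 1 _ = refl
centre-nbr-injective (suc (suc s)) (suc (suc t)) e = cong (2 +_) (+-cancelˡ-≡ 4 s t e)
centre-nbr-injective 0 1 ()
centre-nbr-injective 0 (suc (suc t)) ()
centre-nbr-injective 1 0 ()
centre-nbr-injective 1 (suc (suc t)) ()
centre-nbr-injective (suc (suc s)) 0 ()
centre-nbr-injective (suc (suc s)) 1 ()

centre-nbr-bound : ∀ m s → s < 2 + m → centre-nbr s < 4 + m
centre-nbr-bound m 0 _ = s≤s (s≤s z≤n)
centre-nbr-bound m 1 _ = s≤s (s≤s (s≤s (s≤s z≤n)))
centre-nbr-bound m (suc (suc s)) (s≤s (s≤s s<m)) = s≤s (s≤s (s≤s (s≤s s<m)))

-- Lower-bound criterion: the centre of a monochromatic F_{2,m+2} has m + 2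
-- neighbours in its colour, so a colouring in which every vertex has at most
-- m + 1 neighbours in each colour contains no monochromatic F_{2,m+2}.
no-copy-if-low-degree : ∀ {M} (C : Colouring M) (m : ℕ) → (∀ k z → deg C k z ≤ suc m) →
  ¬ MonoCopy (F2 (suc (suc m))) C
no-copy-if-low-degree {M} C m low (φ , φ-injective , k , mono) =
  <-irrefl refl (≤-trans many (low k z))
  where
  L : ℕ
  L = suc (suc m) + 2
  z : Fin M
  z = φ zero
  index : ℕ → Fin L
  index s = centre-nbr s mod L
  toℕ-index : ∀ s → s < 2 + m → toℕ (index s) ≡ centre-nbr s
  toℕ-index s lt = trans (toℕ-fromℕ< _)
    (m<n⇒m%n≡m (subst (centre-nbr s <_) (cong (2 +_) (+-comm 2 m)) (centre-nbr-bound m s lt)))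
  nbr : ℕ → Fin M
  nbr s = φ (index s)
  nbr-member : ∀ s → s < 2 + m → Nbhd C k z (nbr s) ≡ true
  nbr-member s lt = without-intro (λ u → Colouring.col C z u == k)
    (dec-true (Colouring.col C z (nbr s) ≟ᶠ k) (mono zero (index s) adjacent))
    (λ e → centre-nbr-nonzero s (trans (sym (toℕ-index s lt)) (cong toℕ (φ-injective e))))
    where
    adjacent : F-adjℕ 0 (toℕ (index s)) ≡ true
    adjacent = subst (λ t → F-adjℕ 0 t ≡ true) (sym (toℕ-index s lt)) (centre-nbr-adjacent s)
  many : 2 + m ≤ deg C k z
  many = count-injection (2 + m) (Nbhd C k z) nbr nbr-member
    (λ s t ls lt e → centre-nbr-injective s t
       (trans (sym (toℕ-index s ls)) (trans (cong toℕ (φ-injective e)) (toℕ-index t lt))))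

-- Arrowing is monotone in the number of vertices: restrict to the first N.
arrows-mono : ∀ {N M H} → N ≤ M → Arrows N H → Arrows M H
arrows-mono {N} {M} {H} N≤M arrows C with arrows restricted
  where
  restricted : Colouring N
  restricted = record { col = λ u v → Colouring.col C (inject≤ u N≤M) (inject≤ v N≤M)
                      ; sym = λ u v → Colouring.sym C (inject≤ u N≤M) (inject≤ v N≤M) }
... | φ , φ-injective , k , mono =
  (λ x → inject≤ (φ x) N≤M) , (λ e → φ-injective (inject≤-injective N≤M N≤M _ _ e)) , k , mono

ramsey-number : ∀ {H} M R → suc M ≡ R → Arrows (suc M) H → ¬ Arrows M H → IsRamsey2 H R
ramsey-number {H} M R refl arrows not-arrows =
  arrows , λ N N<R arrowsN → not-arrows (arrows-mono {N} {M} {H} (≤-pred N<R) arrowsN)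

-- Call colour i red and the other colour blue, R the red and B the blue
-- neighbourhood of x.
module HighDegree {N : ℕ} (C : Colouring N) (m : ℕ) (1≤m : 1 ≤ m) (room : 5 + m ≤ N)
                  (x : Fin N) (i : Fin 2) where

  col : Fin N → Fin N → Fin 2
  col = Colouring.col C

  j : Fin 2
  j = other i

  Red Blue : Fin N → Fin N → Bool
  Red u v = col u v == i
  Blue u v = col u v == j

  not-blue : ∀ u v → not (Blue u v) ≡ Red v u
  not-blue u v = trans (cong not (==-other (col u v) i))
                   (trans (not-involutive _) (cong (_== i) (Colouring.sym C u v)))

  blue-if-not-red : ∀ {u v} → Red v u ≡ false → col u v ≡ j
  blue-if-not-red {u} {v} nr = ==-sound (trans (==-other (col u v) i)
                                 (cong not (trans (cong (_== i) (Colouring.sym C u v)) nr)))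

  R B : Fin N → Bool
  R = Nbhd C i x
  B = Nbhd C j x

  d : ℕ
  d = count R

  R-col : ∀ {u} → R u ≡ true → col x u ≡ i
  R-col = Nbhd-col C

  B-col : ∀ {u} → B u ≡ true → col x u ≡ j
  B-col = Nbhd-col C

  R-≢ : ∀ {u} → R u ≡ true → u ≢ x
  R-≢ = without-≢ (λ u → Red x u)

  B-≢ : ∀ {u} → B u ≡ true → u ≢ x
  B-≢ = without-≢ (λ u → Blue x u)

  R-B-disjoint : ∀ {u v} → R u ≡ true → B v ≡ true → u ≢ v
  R-B-disjoint hu hv refl = other-≢ i (trans (sym (R-col hu)) (B-col hv))

  B-not-R : ∀ {b} → B b ≡ true → R b ≡ false
  B-not-R {b} hb with R b in hr
  ... | true = ⊥-elim (R-B-disjoint hr hb refl)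
  ... | false = refl

  not-R-B : ∀ {b} → b ≢ x → R b ≡ false → B b ≡ true
  not-R-B {b} b≢x nr with Red x b in red
  ... | true with () ← trans (sym nr) (cong not (==-false b≢x))
  ... | false = without-intro (λ u → Blue x u) (trans (==-other (col x b) i) (cong not red)) b≢x

  -- Since x has N − 1 neighbours, few blue neighbours force many red ones.
  red-large : ∀ k → count B ≤ k → 4 + m ≤ d + k
  red-large k B≤k = ≤-pred (begin
    5 + m               ≤⟨ room ⟩
    N                   ≡⟨ sym (degree-sum C i x) ⟩
    suc (d + count B)   ≤⟨ s≤s (+-monoʳ-≤ d B≤k) ⟩
    suc (d + k)         ∎)
    where open ≤-Reasoning

  red-large₁ : count B ≤ 1 → 3 + m ≤ d
  red-large₁ B≤1 = ≤-pred (subst (4 + m ≤_) (+-comm d 1) (red-large 1 B≤1))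

  red-large₀ : count B ≤ 0 → 4 + m ≤ d
  red-large₀ B≤0 = subst (4 + m ≤_) (+-identityʳ d) (red-large 0 B≤0)

  R-minus-member : ∀ {k b} → R b ≡ true → suc k + m ≤ d → k + m ≤ count (without R b)
  R-minus-member {k} hb enough = ≤-pred (subst (suc k + m ≤_) (count-without-member R hb) enough)

  RedTo : Fin N → Fin N → Bool
  RedTo b = without R b ∩ (λ a → Red a b)

  Sparse : Fin N → Set
  Sparse b = count (RedTo b) ≤ 1

  few-red : ∀ y → Sparse y → (f : Fin N → Bool) → (∀ u → f u ≡ true → without R y u ≡ true) →
    count f ≤ suc (count (f ∩ Blue y))
  few-red y sparse f f⊆ = count-all-but-one f (Blue y) (≤-trans (count-mono red) sparse)
    where
    red : ∀ u → (f ∖ Blue y) u ≡ true → RedTo y u ≡ true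
    red u h = ∧-intro (f⊆ u (∧-conicalˡ _ _ h)) (trans (sym (not-blue y u)) (∧-conicalʳ _ _ h))

  Goal : Set
  Goal = MonoCopy (F2 (suc (suc m))) C

  -- Case "two red paths": b ≠ x has two red neighbours a, c in R ∖ {b}.  Then
  -- x–a–b–c–x is a red 4-cycle and R ∖ {a, b, c} supplies the pendants at x.
  red-cycle : ∀ b → b ≢ x → 2 + m ≤ count (without R b) → 2 ≤ count (RedTo b) → Goal
  red-cycle b b≢x enough two with count-two (RedTo b) two
  ... | a , c , ha , hc , a≢c = copy-from-cycle cycle m P (leaves enough removal) pendant
    where
    a∈ : without R b a ≡ true
    a∈ = ∧-conicalˡ _ _ ha
    c∈ : without R b c ≡ true
    c∈ = ∧-conicalˡ _ _ hc
    Ra : R a ≡ true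
    Ra = without-⊆ R a∈
    Rc : R c ≡ true
    Rc = without-⊆ R c∈
    cycle : Cycle4 C i
    cycle = record
      { z = x ; a = a ; b = b ; w = c
      ; z≢a = λ e → R-≢ Ra (sym e) ; z≢b = λ e → b≢x (sym e) ; z≢w = λ e → R-≢ Rc (sym e)
      ; a≢b = without-≢ R a∈ ; a≢w = a≢c ; b≢w = λ e → without-≢ R c∈ (sym e)
      ; za = R-col Ra ; ab = ==-sound (∧-conicalʳ _ _ ha)
      ; bw = col-flip C (==-sound (∧-conicalʳ _ _ hc)) ; wz = col-flip C (R-col Rc) }
    P : Fin N → Bool
    P = without (without (without R b) a) c
    removal : count (without R b) ≤ 2 + count P
    removal = ≤-trans (count-without (without R b) a) (s≤s (count-without (without (without R b) a) c))
    pendant : ∀ u → P u ≡ true → Pendant cycle u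
    pendant u h = record { joined = R-col Ru ; u≢z = R-≢ Ru ; u≢a = without-≢ (without R b) h₂
                         ; u≢b = without-≢ R h₃ ; u≢w = without-≢ (without (without R b) a) h }
      where
      h₂ : without (without R b) a u ≡ true
      h₂ = without-⊆ (without (without R b) a) h
      h₃ : without R b u ≡ true
      h₃ = without-⊆ (without R b) h₂
      Ru : R u ≡ true
      Ru = without-⊆ R h₃

  -- All but at most two
  -- vertices of R are blue to both, so some c ∈ R is; then y–x–y'–c–y is a
  -- blue 4-cycle and the vertices of R ∖ {c} blue to y supply the pendants at y.
  two-blue : 2 + m ≤ d → ∀ y y' → B y ≡ true → B y' ≡ true → y ≢ y' →
    Sparse y → Sparse y' → Goal
  two-blue enough y y' hy hy' y≢y' sparse sparse'
    with count-witness T (leaves (≤-trans (s≤s (s≤s 1≤m)) enough) twice)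
    where
    R-avoids : ∀ {z} → B z ≡ true → ∀ u → R u ≡ true → without R z u ≡ true
    R-avoids hz u Ru = without-intro R Ru (R-B-disjoint Ru hz)
    T : Fin N → Bool
    T = (R ∩ Blue y) ∩ Blue y'
    twice : d ≤ 2 + count T
    twice = ≤-trans (few-red y sparse R (R-avoids hy))
      (s≤s (few-red y' sparse' (R ∩ Blue y) (λ u h → R-avoids hy' u (∧-conicalˡ _ _ h))))
  ... | c , hc = copy-from-cycle cycle m P (leaves enough removal) pendant
    where
    hc₁ : (R ∩ Blue y) c ≡ true
    hc₁ = ∧-conicalˡ _ _ hc
    Rc : R c ≡ true
    Rc = ∧-conicalˡ _ _ hc₁
    cycle : Cycle4 C j
    cycle = record
      { z = y ; a = x ; b = y' ; w = c
      ; z≢a = B-≢ hy ; z≢b = y≢y' ; z≢w = λ e → R-B-disjoint Rc hy (sym e)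
      ; a≢b = λ e → B-≢ hy' (sym e) ; a≢w = λ e → R-≢ Rc (sym e)
      ; b≢w = λ e → R-B-disjoint Rc hy' (sym e)
      ; za = col-flip C (B-col hy) ; ab = B-col hy'
      ; bw = ==-sound (∧-conicalʳ _ _ hc) ; wz = col-flip C (==-sound (∧-conicalʳ _ _ hc₁)) }
    P : Fin N → Bool
    P = without (R ∩ Blue y) c
    removal : d ≤ 2 + count P
    removal = ≤-trans (few-red y sparse R (λ u Ru → without-intro R Ru (R-B-disjoint Ru hy)))
                      (s≤s (count-without (R ∩ Blue y) c))
    pendant : ∀ u → P u ≡ true → Pendant cycle u
    pendant u h = record { joined = ==-sound (∧-conicalʳ _ _ h₁) ; u≢z = R-B-disjoint Ru hy ; u≢a = R-≢ Ru
                         ; u≢b = R-B-disjoint Ru hy' ; u≢w = without-≢ (R ∩ Blue y) h }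
      where
      h₁ : (R ∩ Blue y) u ≡ true
      h₁ = without-⊆ (R ∩ Blue y) h
      Ru : R u ≡ true
      Ru = ∧-conicalˡ _ _ h₁

  -- A sparse vertex z has a "partner" w ∈ R ∖ {z} (provided R ∖ {z} ≠ ∅) such
  -- that z is blue to every other vertex of R ∖ {z}: take w to be its unique
  -- red neighbour there if it has one, and any vertex otherwise.
  partner : ∀ z → Sparse z → ∀ w₀ → without R z w₀ ≡ true →
    Σ (Fin N) λ w → without R z w ≡ true × (∀ u → without R z u ≡ true → u ≢ w → col z u ≡ j)
  partner z sparse w₀ hw₀ with any? (λ w → RedTo z w ≟ᵇ true)
  ... | yes (w , hw) = w , ∧-conicalˡ _ _ hw , blue
    where
    blue : ∀ u → without R z u ≡ true → u ≢ w → col z u ≡ j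
    blue u hu u≢w with Red u z in red
    ... | true = ⊥-elim (u≢w (count-≤1 (RedTo z) sparse (∧-intro hu red) hw))
    ... | false = blue-if-not-red red
  ... | no none = w₀ , hw₀ , blue
    where
    blue : ∀ u → without R z u ≡ true → u ≢ w₀ → col z u ≡ j
    blue u hu _ with Red u z in red
    ... | true = ⊥-elim (none (u , ∧-intro hu red))
    ... | false = blue-if-not-red red

  -- With w the partner of z, two vertices a, c
  -- of R ∖ {z, w} are blue to w; then z–a–w–c–z is a blue 4-cycle and
  -- R ∖ {z, w, a, c} supplies the pendants at z.
  blue-cycle : (∀ b → b ≢ x → Sparse b) → ∀ z → z ≢ x → 3 + m ≤ count (without R z) → Goal
  blue-cycle sparse z z≢x enough with count-witness (without R z) (≤-trans (s≤s z≤n) enough)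
  ... | w₀ , hw₀ with partner z (sparse z z≢x) w₀ hw₀
  ... | w , hw , blue with count-two Q (leaves (≤-trans (s≤s (s≤s (s≤s 1≤m))) enough) twice)
    where
    R′ : Fin N → Bool
    R′ = without R z
    Q : Fin N → Bool
    Q = without R′ w ∩ Blue w
    twice : count R′ ≤ 2 + count Q
    twice = ≤-trans (count-without R′ w)
      (s≤s (few-red w (sparse w (R-≢ (without-⊆ R hw))) (without R′ w)
             (λ u h → without-intro R (without-⊆ R (without-⊆ R′ h)) (without-≢ R′ h))))
  ... | a , c , ha , hc , a≢c = copy-from-cycle cycle m P (leaves enough removal) pendant
    where
    R′ : Fin N → Bool
    R′ = without R z
    a∈ : without R′ w a ≡ true
    a∈ = ∧-conicalˡ _ _ ha
    c∈ : without R′ w c ≡ true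
    c∈ = ∧-conicalˡ _ _ hc
    a≢w : a ≢ w
    a≢w = without-≢ R′ a∈
    c≢w : c ≢ w
    c≢w = without-≢ R′ c∈
    cycle : Cycle4 C j
    cycle = record
      { z = z ; a = a ; b = w ; w = c
      ; z≢a = λ e → without-≢ R (without-⊆ R′ a∈) (sym e) ; z≢b = λ e → without-≢ R hw (sym e)
      ; z≢w = λ e → without-≢ R (without-⊆ R′ c∈) (sym e)
      ; a≢b = a≢w ; a≢w = a≢c ; b≢w = λ e → c≢w (sym e)
      ; za = blue a (without-⊆ R′ a∈) a≢w ; ab = col-flip C (==-sound (∧-conicalʳ _ _ ha))
      ; bw = ==-sound (∧-conicalʳ _ _ hc) ; wz = col-flip C (blue c (without-⊆ R′ c∈) c≢w) }
    P : Fin N → Bool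
    P = without (without (without R′ w) a) c
    removal : count R′ ≤ 3 + count P
    removal = ≤-trans (count-without R′ w)
      (s≤s (≤-trans (count-without (without R′ w) a) (s≤s (count-without (without (without R′ w) a) c))))
    pendant : ∀ u → P u ≡ true → Pendant cycle u
    pendant u h = record { joined = blue u h₃ u≢w ; u≢z = without-≢ R h₃
                         ; u≢a = without-≢ (without R′ w) h₁ ; u≢b = u≢w
                         ; u≢w = without-≢ (without (without R′ w) a) h }
      where
      h₁ : without (without R′ w) a u ≡ true
      h₁ = without-⊆ (without (without R′ w) a) h
      h₂ : without R′ w u ≡ true
      h₂ = without-⊆ (without R′ w) h₁
      h₃ : R′ u ≡ true
      h₃ = without-⊆ R′ h₂
      u≢w : u ≢ w
      u≢w = without-≢ R′ h₂

  all-sparse : (∀ b → B b ≡ true → Sparse b) → (∀ b → R b ≡ true → Sparse b) →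
    ∀ b → b ≢ x → Sparse b
  all-sparse sparse-B sparse-R b b≢x with R b in hb
  ... | true = sparse-R b hb
  ... | false = sparse-B b (not-R-B b≢x hb)

  -- Choosing the centre of the blue cycle: a blue neighbour of x if there is
  -- one (then R ∖ {z} = R), and otherwise a red one (then d ≥ m + 4).
  blue-cycle-somewhere : count B ≤ 1 → (∀ b → b ≢ x → Sparse b) → Goal
  blue-cycle-somewhere B≤1 sparse with 0 <? count B
  ... | yes B≠∅ =
    let (y , hy) = count-witness B B≠∅ in
    blue-cycle sparse y (B-≢ hy)
      (subst (3 + m ≤_) (sym (count-without-nonmember R (B-not-R hy))) (red-large₁ B≤1))
  ... | no B=∅ =
    let four = red-large₀ (≮⇒≥ B=∅)
        (w , hw) = count-witness R (≤-trans (s≤s z≤n) four) in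
    blue-cycle sparse w (R-≢ hw) (R-minus-member hw four)

  high-degree : 2 + m ≤ d → Goal
  high-degree enough with any? (λ b → (B b ≟ᵇ true) ×-dec (2 ≤? count (RedTo b)))
  ... | yes (b , hb , two) =
    red-cycle b (B-≢ hb) (subst (2 + m ≤_) (sym (count-without-nonmember R (B-not-R hb))) enough) two
  ... | no dense-B = sparse-blue (λ b hb → ≮⇒≥ (λ two → dense-B (b , hb , two)))
    where
    sparse-blue : (∀ b → B b ≡ true → Sparse b) → Goal
    sparse-blue sparse-B with 2 ≤? count B
    ... | yes two =
      let (y , y' , hy , hy' , y≢y') = count-two B two in
      two-blue enough y y' hy hy' y≢y' (sparse-B y hy) (sparse-B y' hy')
    ... | no ¬two with any? (λ b → (R b ≟ᵇ true) ×-dec (2 ≤? count (RedTo b)))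
    ...   | yes (b , hb , two) = red-cycle b (R-≢ hb) (R-minus-member hb (red-large₁ (≮⇒≥ ¬two))) two
    ...   | no dense-R = blue-cycle-somewhere (≮⇒≥ ¬two)
                           (all-sparse sparse-B (λ b hb → ≮⇒≥ (λ two → dense-R (b , hb , two))))

colouring-from : ∀ {M} (red : Fin M → Fin M → Bool) → (∀ u v → red u v ≡ red v u) → Colouring M
colouring-from red red-sym = record
  { col = λ u v → if red u v then zero else suc zero
  ; sym = λ u v → cong (λ b → if b then zero else suc zero) (red-sym u v) }

degree-from : ∀ {M} (red : Fin M → Fin M → Bool) (red-sym : ∀ u v → red u v ≡ red v u) (D : ℕ) →
  (∀ z → count (without (red z) z) ≤ D) → (∀ z → count (without (λ u → not (red z u)) z) ≤ D) →
  ∀ k z → deg (colouring-from red red-sym) k z ≤ D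
degree-from {M} red red-sym D related unrelated k z =
  ≤-trans (count-mono (λ u h → without-intro (λ v → Holds k (red z v))
                                 (coloured k (red z u) (==-sound (without-⊆ (λ v → col z v == k) h)))
                                 (without-≢ (λ v → col z v == k) h)))
          (bound k)
  where
  col : Fin M → Fin M → Fin 2
  col = Colouring.col (colouring-from red red-sym)
  Holds : Fin 2 → Bool → Bool
  Holds zero b = b
  Holds (suc zero) b = not b
  coloured : ∀ k b → (if b then zero else suc zero) ≡ k → Holds k b ≡ true
  coloured zero true _ = refl
  coloured (suc zero) false _ = refl
  coloured zero false ()
  coloured (suc zero) true ()
  bound : ∀ k → count (without (λ u → Holds k (red z u)) z) ≤ D
  bound zero = related z
  bound (suc zero) = unrelated z

-- Lower bound for even n = m + 2: colour K_{2m+2} red inside and blue between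
-- two halves of size m + 1.  Every vertex has red degree m and blue degree m + 1.
module TwoCliques (m : ℕ) where
  M : ℕ
  M = suc m + suc m

  first-half : Fin M → Bool
  first-half u = toℕ u <ᵇ suc m

  same-half : Fin M → Fin M → Bool
  same-half u v = not (first-half u xor first-half v)

  half : ∀ c → count (λ u → c xor first-half u) ≡ suc m
  half false = count-below (suc m) (m≤m+n (suc m) (suc m))
  half true = +-cancelˡ-≡ (suc m) _ _ (begin
    suc m + count (λ u → not (first-half u))
      ≡⟨ cong (_+ count (λ u → not (first-half u))) (sym (half false)) ⟩
    count first-half + count (λ u → not (first-half u))
      ≡⟨ sym (count-split (λ _ → true) first-half) ⟩
    count {M} (λ _ → true)
      ≡⟨ count-all ⟩
    suc m + suc m ∎)
    where open ≡-Reasoning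

  same-half-sym : ∀ u v → same-half u v ≡ same-half v u
  same-half-sym u v = cong not (xor-comm (first-half u) (first-half v))

  colouring : Colouring M
  colouring = colouring-from same-half same-half-sym

  low-degree : ∀ k z → deg colouring k z ≤ suc m
  low-degree = degree-from same-half same-half-sym (suc m) same-bound other-bound
    where
    not-xor : ∀ a b → not (a xor b) ≡ (not a xor b)
    not-xor true b = not-involutive b
    not-xor false b = refl
    same-bound : ∀ z → count (without (same-half z) z) ≤ suc m
    same-bound z = ≤-trans (count-without-≤ (same-half z) z)
      (≤-reflexive (trans (count-ext (λ u → not-xor (first-half z) (first-half u))) (half (not (first-half z)))))
    other-bound : ∀ z → count (without (λ u → not (same-half z u)) z) ≤ suc m
    other-bound z = ≤-trans (count-without-≤ (λ u → not (same-half z u)) z)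
      (≤-reflexive (trans (count-ext (λ u → not-involutive (first-half z xor first-half u))) (half (first-half z))))

two-cliques-lower : ∀ m → ¬ Arrows (suc m + suc m) (F2 (suc (suc m)))
two-cliques-lower m arrows = no-copy-if-low-degree colouring m low-degree (arrows colouring)
  where open TwoCliques m

module ForwardDistance (M : ℕ) where
  fd : ℕ → ℕ → ℕ
  fd a b with a ≤? b
  ... | yes _ = b ∸ a
  ... | no _ = (b + M) ∸ a

  private
    cancel-∸ : ∀ a {x y} → a ≤ x → a ≤ y → x ∸ a ≡ y ∸ a → x ≡ y
    cancel-∸ a {x} {y} a≤x a≤y e = trans (sym (m∸n+n≡m a≤x)) (trans (cong (_+ a) e) (m∸n+n≡m a≤y))

    ∸-chain : ∀ {a b c} → a ≤ b → b ≤ c → (b ∸ a) + (c ∸ b) ≡ c ∸ a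
    ∸-chain {a} {b} {c} a≤b b≤c = +-cancelʳ-≡ a _ _ (begin
      (b ∸ a) + (c ∸ b) + a   ≡⟨ cong (_+ a) (+-comm (b ∸ a) (c ∸ b)) ⟩
      (c ∸ b) + (b ∸ a) + a   ≡⟨ +-assoc (c ∸ b) (b ∸ a) a ⟩
      (c ∸ b) + ((b ∸ a) + a) ≡⟨ cong ((c ∸ b) +_) (m∸n+n≡m a≤b) ⟩
      (c ∸ b) + b             ≡⟨ m∸n+n≡m b≤c ⟩
      c                       ≡⟨ sym (m∸n+n≡m (≤-trans a≤b b≤c)) ⟩
      (c ∸ a) + a             ∎)
      where open ≡-Reasoning

    below-shift : ∀ {a} b → a < M → a ≤ b + M
    below-shift {a} b a<M = ≤-trans (<⇒≤ a<M) (m≤n+m M b)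

  fd-self : ∀ a → fd a a ≡ 0
  fd-self a with a ≤? a
  ... | yes _ = n∸n≡0 a
  ... | no a≰a = ⊥-elim (a≰a ≤-refl)

  fd-injective : ∀ {a b b'} → a < M → b < M → b' < M → fd a b ≡ fd a b' → b ≡ b'
  fd-injective {a} {b} {b'} a<M b<M b'<M e with a ≤? b | a ≤? b'
  ... | yes a≤b | yes a≤b' = cancel-∸ a a≤b a≤b' e
  ... | yes a≤b | no _ = ⊥-elim (<⇒≱ b<M (subst (M ≤_) (sym b≡) (m≤n+m M b')))
    where
    b≡ : b ≡ b' + M
    b≡ = cancel-∸ a a≤b (below-shift b' a<M) e
  ... | no _ | yes a≤b' = ⊥-elim (<⇒≱ b'<M (subst (M ≤_) b≡ (m≤n+m M b)))
    where
    b≡ : b + M ≡ b'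
    b≡ = cancel-∸ a (below-shift b a<M) a≤b' e
  ... | no _ | no _ = +-cancelʳ-≡ M b b' (cancel-∸ a (below-shift b a<M) (below-shift b' a<M) e)

  fd-round-trip : ∀ {a b} → a < M → b < M → a ≢ b → fd a b + fd b a ≡ M
  fd-round-trip {a} {b} a<M b<M a≢b with a ≤? b | b ≤? a
  ... | yes a≤b | yes b≤a = ⊥-elim (a≢b (≤-antisym a≤b b≤a))
  ... | yes a≤b | no _ = trans (∸-chain a≤b (below-shift a b<M)) (m+n∸m≡n a M)
  ... | no _ | yes b≤a =
    trans (+-comm ((b + M) ∸ a) (a ∸ b)) (trans (∸-chain b≤a (below-shift b a<M)) (m+n∸m≡n b M))
  ... | no a≰b | no b≰a = ⊥-elim (b≰a (<⇒≤ (≰⇒> a≰b)))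

-- Lower bound for odd n = 2t + 1: on the cycle of length M = 4t + 1, colour uv
-- red when u and v are at cyclic distance at most t.  Every vertex then has
-- 2t red and 2t blue neighbours.
module Circulant (t : ℕ) where
  M : ℕ
  M = suc ((t + t) + (t + t))

  open ForwardDistance M

  h : Fin M → Fin M → ℕ
  h u v = fd (toℕ u) (toℕ v)

  short : ℕ → Bool
  short = in-interval 0 t

  near : Fin M → Fin M → Bool
  near u v = short (h u v) ∨ short (h v u)

  near-sym : ∀ u v → near u v ≡ near v u
  near-sym u v = ∨-comm (short (h u v)) (short (h v u))

  colouring : Colouring M
  colouring = colouring-from near near-sym

  h-injective : ∀ z {u v} → h z u ≡ h z v → u ≡ v
  h-injective z e = toℕ-injective (fd-injective (toℕ<n z) (toℕ<n _) (toℕ<n _) e)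

  h-positive : ∀ {z u} → u ≢ z → 0 < h z u
  h-positive {z} {u} u≢z with h z u in e
  ... | zero = ⊥-elim (u≢z (sym (h-injective z (trans (fd-self (toℕ z)) (sym e)))))
  ... | suc _ = s≤s z≤n

  h-round-trip : ∀ {z u} → u ≢ z → h z u + h u z ≡ M
  h-round-trip {z} {u} u≢z = fd-round-trip (toℕ<n z) (toℕ<n u) (λ e → u≢z (sym (toℕ-injective e)))

  red-distance : ∀ z u → u ≢ z → near z u ≡ true →
    (short (h z u) ∨ in-interval (t + t + t) t (h z u)) ≡ true
  red-distance z u u≢z red with short (h z u)
  ... | true = refl
  ... | false = in-interval-intro
        (sum-split-lower (trans (h-round-trip u≢z) (M≡ t)) (in-interval-upper {0} {t} {h u z} red))
        (sum-split-upper (trans (h-round-trip u≢z) (M≡′ t)) (in-interval-lower {0} {t} {h u z} red))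
    where
    M≡ : ∀ t → suc ((t + t) + (t + t)) ≡ suc (t + t + t) + (0 + t)
    M≡ = solve-∀
    M≡′ : ∀ t → suc ((t + t) + (t + t)) ≡ (t + t + t + t) + 1
    M≡′ = solve-∀

  blue-distance : ∀ z u → u ≢ z → not (near z u) ≡ true → in-interval t (t + t) (h z u) ≡ true
  blue-distance z u u≢z blue = in-interval-intro
    (far (h-positive u≢z) (∨-conicalˡ _ _ near-false))
    (sum-split-upper (trans (h-round-trip u≢z) (M≡ t))
      (far (h-positive (λ e → u≢z (sym e))) (∨-conicalʳ _ _ near-false)))
    where
    near-false : near z u ≡ false
    near-false = trans (sym (not-involutive (near z u))) (cong not blue)
    far : ∀ {p} → 0 < p → short p ≡ false → t < p
    far {p} pos not-short =
      ≰⇒> (λ p≤t → false≢true (trans (sym not-short) (in-interval-intro {0} {t} {p} pos p≤t)))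
      where
      false≢true : false ≢ true
      false≢true ()
    M≡ : ∀ t → suc ((t + t) + (t + t)) ≡ (t + (t + t)) + suc t
    M≡ = solve-∀

  low-degree : ∀ k z → deg colouring k z ≤ t + t
  low-degree = degree-from near near-sym (t + t) red-bound blue-bound
    where
    red-bound : ∀ z → count (without (near z) z) ≤ t + t
    red-bound z = begin
      count (without (near z) z)    ≤⟨ count-mono {f = without (near z) z} {g = close ∪ far-back}
                                         (λ u hu → red-distance z u (without-≢ (near z) hu)
                                                                     (without-⊆ (near z) hu)) ⟩
      count (close ∪ far-back)      ≤⟨ count-∪ close far-back ⟩
      count close + count far-back  ≤⟨ +-mono-≤ (count-interval (h z) (h-injective z) 0 t)
                                                (count-interval (h z) (h-injective z) (t + t + t) t) ⟩
      t + t                         ∎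
      where
      open ≤-Reasoning
      close far-back : Fin M → Bool
      close u = short (h z u)
      far-back u = in-interval (t + t + t) t (h z u)
    blue-bound : ∀ z → count (without (λ u → not (near z u)) z) ≤ t + t
    blue-bound z = ≤-trans
      (count-mono {f = without (λ u → not (near z u)) z} {g = λ u → in-interval t (t + t) (h z u)}
        (λ u hu → blue-distance z u (without-≢ (λ v → not (near z v)) hu)
                                    (without-⊆ (λ v → not (near z v)) hu)))
      (count-interval (h z) (h-injective z) t (t + t))

circulant-lower : ∀ t m → suc m ≡ t + t → ¬ Arrows (suc (suc m + suc m)) (F2 (suc (suc m)))
circulant-lower t m e arrows =
  no-copy-if-low-degree colouring m (λ k z → subst (deg colouring k z ≤_) (sym e) (low-degree k z))
    (subst (λ N → Arrows N (F2 (suc (suc m)))) (cong (λ s → suc (s + s)) e) arrows colouring)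
  where open Circulant t

room-even : ∀ m → 1 ≤ m → 5 + m ≤ suc (suc (suc m + suc m))
room-even m 1≤m = begin
  5 + m                     ≡⟨ e₁ m ⟩
  4 + (m + 1)               ≤⟨ +-monoʳ-≤ 4 (+-monoʳ-≤ m 1≤m) ⟩
  4 + (m + m)               ≡⟨ e₂ m ⟩
  suc (suc (suc m + suc m)) ∎
  where
  open ≤-Reasoning
  e₁ : ∀ m → 5 + m ≡ 4 + (m + 1)
  e₁ = solve-∀
  e₂ : ∀ m → 4 + (m + m) ≡ suc (suc (suc m + suc m))
  e₂ = solve-∀

room-odd : ∀ m → 2 ≤ m → 5 + m ≤ suc (suc m + suc m)
room-odd m 2≤m = begin
  5 + m               ≡⟨ e₁ m ⟩
  3 + (m + 2)         ≤⟨ +-monoʳ-≤ 3 (+-monoʳ-≤ m 2≤m) ⟩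
  3 + (m + m)         ≡⟨ e₂ m ⟩
  suc (suc m + suc m) ∎
  where
  open ≤-Reasoning
  e₁ : ∀ m → 5 + m ≡ 3 + (m + 2)
  e₁ = solve-∀
  e₂ : ∀ m → 3 + (m + m) ≡ suc (suc m + suc m)
  e₂ = solve-∀

-- Upper bound for the order 2m + 4: vertex 0 has 2m + 3 neighbours, hence
-- m + 2 of them in one colour.
arrows-even-order : ∀ m → 1 ≤ m → Arrows (suc (suc (suc m + suc m))) (F2 (suc (suc m)))
arrows-even-order m 1≤m C with 2 + m ≤? deg C zero zero
... | yes many = HighDegree.high-degree C m 1≤m (room-even m 1≤m) zero zero many
... | no few = HighDegree.high-degree C m 1≤m (room-even m 1≤m) zero (suc zero)
                 (other-colour-large C zero zero (2 + m) (suc m) refl (≮⇒≥ few))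

-- Otherwise every vertex has exactly m + 1 neighbours of
-- colour 0, and these degrees add up to the odd number (2m + 3)(m + 1),
-- contradicting the handshake lemma.
not-all-low : ∀ m → ¬ 2 ∣ suc m → (C : Colouring (suc (suc m + suc m))) →
  ¬ (∀ k x → deg C k x ≤ suc m)
not-all-low m odd C low = odd-product (subst (2 ∣_) degree-total (handshake E E-sym E-irrefl))
  where
  N : ℕ
  N = suc (suc m + suc m)
  E : Fin N → Fin N → Bool
  E = Nbhd C zero
  E-sym : ∀ u v → E u v ≡ E v u
  E-sym u v = cong₂ _∧_ (cong (_== zero) (Colouring.sym C u v)) (cong not (==-sym v u))
  E-irrefl : ∀ u → E u u ≡ false
  E-irrefl u rewrite ==-refl u = ∧-zeroʳ _
  exact : ∀ x → deg C zero x ≡ suc m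
  exact x = ≤-antisym (low zero x) (other-colour-large C (suc zero) x (suc m) (suc m) refl (low (suc zero) x))
  degree-total : sum (λ x → count (E x)) ≡ N * suc m
  degree-total = trans (sum-cong-≗ exact) (sum-const {N} (suc m))
  odd-product : ¬ 2 ∣ N * suc m
  odd-product 2∣ with euclidsLemma N (suc m) prime[2] 2∣
  ... | inj₁ 2∣N = consecutive (divides (suc m) (double≡*2 (suc m))) 2∣N
  ... | inj₂ 2∣m+1 = odd 2∣m+1

odd-successor : ∀ {m} → 1 ≤ m → ¬ 2 ∣ suc m → 2 ≤ m
odd-successor {suc zero} _ odd = ⊥-elim (odd (divides 1 refl))
odd-successor {suc (suc m)} _ _ = s≤s (s≤s z≤n)

arrows-odd-order : ∀ m → 1 ≤ m → ¬ 2 ∣ suc m → Arrows (suc (suc m + suc m)) (F2 (suc (suc m)))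
arrows-odd-order m 1≤m odd C with any? (λ x → (2 + m ≤? deg C zero x) ⊎-dec (2 + m ≤? deg C (suc zero) x))
... | yes (x , inj₁ many) = HighDegree.high-degree C m 1≤m (room-odd m (odd-successor 1≤m odd)) x zero many
... | yes (x , inj₂ many) = HighDegree.high-degree C m 1≤m (room-odd m (odd-successor 1≤m odd)) x (suc zero) many
... | no none = ⊥-elim (not-all-low m odd C low)
  where
  low : ∀ k x → deg C k x ≤ suc m
  low zero x = ≮⇒≥ (λ many → none (x , inj₁ many))
  low (suc zero) x = ≮⇒≥ (λ many → none (x , inj₂ many))

-- The two orders in the statement for n = m + 2: 2n ∸ 1, which unfolds to the
-- right-hand side of order-even, and 2n.
order-even : ∀ m → 2 + (m + (1 + m)) ≡ 1 + (m + (2 + (m + 0)))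
order-even = solve-∀

order-odd : ∀ m → 3 + (m + (1 + m)) ≡ 2 * (2 + m)
order-odd = solve-∀

theorem3p1 : (n : ℕ) → 3 ≤ n →
    (2 ∣ n → IsRamsey2 (F2 n) (2 * n ∸ 1)) × (¬ (2 ∣ n) → IsRamsey2 (F2 n) (2 * n))
theorem3p1 (suc (suc m)) (s≤s (s≤s 1≤m)) = even-case , odd-case
  where
  even-case : 2 ∣ suc (suc m) → IsRamsey2 (F2 (suc (suc m))) (2 * suc (suc m) ∸ 1)
  even-case 2∣n = ramsey-number {F2 (suc (suc m))} (suc m + suc m) _ (order-even m)
    (arrows-odd-order m 1≤m (λ 2∣m+1 → consecutive 2∣m+1 2∣n)) (two-cliques-lower m)
  odd-case : ¬ 2 ∣ suc (suc m) → IsRamsey2 (F2 (suc (suc m))) (2 * suc (suc m))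
  odd-case 2∤n with odd-half (suc (suc m)) 2∤n
  ... | t , n≡ = ramsey-number {F2 (suc (suc m))} (suc (suc m + suc m)) _ (order-odd m)
    (arrows-even-order m 1≤m) (circulant-lower t m (suc-injective n≡))
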